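{- For every integer $m>3$, the Graver complexity $g(m):=g\left((1,1,1)^{(m)}\right)$ of the matrix $(1,1,1)^{(m)}$ satisfies $g(m)\geq 17\cdot 2^{m-3}-7$.
   Context: For an $s\times t$ integer matrix $A$ and a positive integer $n$, the $n$-fold product of $A$ is the $(t+ns)\times nt$ matrix $A^{(n)}:=({\bf 1}_n\otimes I_t)\oplus(I_n\otimes A)$, i.e. the block matrix whose first block row is $(I_t, I_t,\dots,I_t)$ ($n$ copies of the $t\times t$ identity) followed by the block-diagonal matrix with $n$ diagonal copies of $A$. In particular $(1,1,1)^{(m)}$ is the $m$-fold product of the $1\times 3$ matrix $(1,1,1)$, which is the $(3+m)\times 3m$ vertex-edge incidence matrix of the complete bipartite graph $K_{3,m}$. On $\mathbb{Z}^N$ define the partial order $u\sqsubseteq v$ iff $|u_i|\le|v_i|$ and $u_iv_i\ge 0$ for all $i$. The Graver basis $\mathcal{G}(B)$ of an integer matrix $B$ with $N$ columns is the (finite) set of $\sqsubseteq$-minimal elements of $\{x\in\mathbb{Z}^N: Bx=0,\ x\neq 0\}$. For an $s\times t$ integer matrix $A$ and $x\in\mathbb{Z}^{nt}$ written in blocks $x=(x^1,\dots,x^n)$ with $x^i\in\mathbb{Z}^t$, the type of $x$ is the number of indices $i$ with $x^i\neq 0$. The Graver complexity of $A$ is $g(A):=\sup\left(\{0\}\cup\{\mathrm{type}(x): x\in\bigcup_{n\ge1}\mathcal{G}(A^{(n)})\}\right)$. -}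

module Defs where

open import Data.Nat using (ℕ; zero; suc; _≤_)
open import Data.Integer using (ℤ; _+_; _*_; ∣_∣; 0ℤ; 1ℤ) renaming (_≤_ to _≤ℤ_)
open import Data.Integer.Properties using () renaming (_≟_ to _≟ℤ_)
open import Data.Fin using (Fin; zero; suc; splitAt; remQuot; combine)
open import Data.Fin.Properties using (all?) renaming (_≟_ to _≟F_)
open import Data.Sum using ([_,_]′)
open import Data.Product using (Σ; ∃; _×_; _,_; proj₁; proj₂)
open import Relation.Binary.PropositionalEquality using (_≡_)
open import Relation.Nullary using (¬_; Dec; yes; no)
open import Relation.Nullary.Decidable using (¬?)

Matrix : ℕ → ℕ → Set
Matrix r c = Fin r → Fin c → ℤ

Vect : ℕ → Set
Vect N = Fin N → ℤ

Σ[_] : (n : ℕ) → (Fin n → ℤ) → ℤ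
Σ[ zero ] f = 0ℤ
Σ[ suc n ] f = f zero + Σ[ n ] (λ i → f (suc i))

-- The n-fold product A^(n) = (1_n ⊗ I_t) ⊕ (I_n ⊗ A), a (t + n s) × (n t) matrix.
-- Column index (i , k) ↦ combine i k  (block i ∈ Fin n, position k ∈ Fin t).
-- Row index: first t rows (splitAt t, inj₁) form (I_t, …, I_t);
-- remaining n·s rows (inj₂, split by remQuot as (block i, row a of A)) are block-diagonal.
nfold : {s t : ℕ} → Matrix s t → (n : ℕ) → Matrix (t Data.Nat.+ n Data.Nat.* s) (n Data.Nat.* t)
nfold {s} {t} A n row col =
  [ (λ j → ident j (proj₂ (remQuot {n} t col)))
  , (λ r → blockDiag (remQuot {n} s r) (remQuot {n} t col))
  ]′ (splitAt t row)
  where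
  ident : Fin t → Fin t → ℤ
  ident j k with j ≟F k
  ... | yes _ = 1ℤ
  ... | no _  = 0ℤ
  blockDiag : Fin n × Fin s → Fin n × Fin t → ℤ
  blockDiag (i , a) (i′ , k) with i ≟F i′
  ... | yes _ = A a k
  ... | no _  = 0ℤ

_·_ : {r c : ℕ} → Matrix r c → Vect c → Vect r
(B · x) i = Σ[ _ ] (λ j → B i j * x j)

InKernel : {r c : ℕ} → Matrix r c → Vect c → Set
InKernel B x = ∀ i → (B · x) i ≡ 0ℤ

NonZero : {N : ℕ} → Vect N → Set
NonZero x = ¬ (∀ i → x i ≡ 0ℤ)

_⊑_ : {N : ℕ} → Vect N → Vect N → Set
u ⊑ v = ∀ i → (∣ u i ∣ ≤ ∣ v i ∣) × (0ℤ ≤ℤ u i * v i)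

InGraver : {r c : ℕ} → Matrix r c → Vect c → Set
InGraver B x =
  InKernel B x × NonZero x ×
  (∀ y → InKernel B y → NonZero y → y ⊑ x → ∀ i → y i ≡ x i)

count : (n : ℕ) → {P : Fin n → Set} → (∀ i → Dec (P i)) → ℕ
count zero    d = 0
count (suc n) d with d zero
... | yes _ = suc (count n (λ i → d (suc i)))
... | no _  = count n (λ i → d (suc i))

block : {n t : ℕ} → Vect (n Data.Nat.* t) → Fin n → Vect t
block x i k = x (combine i k)

type : (n : ℕ) {t : ℕ} → Vect (n Data.Nat.* t) → ℕ
type n {t} x = count n (λ i → ¬? (all? (λ k → block {n} {t} x i k ≟ℤ 0ℤ)))

-- "g(A) ≥ k": the supremum of {0} ∪ {type(x) : x ∈ ⋃_n 𝒢(A^(n))} is at least k.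
-- For a set of naturals (sup possibly ∞) and k ≥ 1 this is exactly: some element has type ≥ k.
GraverComplexity≥ : {s t : ℕ} → Matrix s t → ℕ → Set
GraverComplexity≥ {s} {t} A k =
  Σ ℕ λ n → Σ (Vect (n Data.Nat.* t)) λ x → InGraver (nfold A n) x × k ≤ type n {t} x

ones111 : Matrix 1 3
ones111 _ _ = 1ℤ

-- B = (1,1,1)^(m) is the incidence matrix of K_{3,m}; its kernel consists of the
-- balanced m × 3 tables (all row and column sums zero), and every 6-cycle of
-- K_{3,m} is a Graver element of B.  The general stacking theorem: if G_1 … G_J
-- are Graver elements of B and a is a primitive relation among them
-- (Σ a_g G_g = 0, and 0 and a are the only relations s with 0 ≤ s ≤ a), then the
-- vector made of a_g copies of each G_g is a Graver element of B^(n), n = Σ a_g,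
-- with all n blocks nonzero; so g(B) ≥ n.  For m = 4 + k we exhibit 7 + 2k cycles
-- whose relations are exactly the multiples of a with Σ a_g = 17 · 2^(k+1) − 7:
-- seven cycles of K_{3,4} (their relations are determined by an explicit linear
-- certificate checked by evaluation), and a doubling step adding one vertex.

module Submission where

open import Defs
open import Data.Nat using (ℕ; zero; suc)

module Construction where
  import Data.Nat as ℕ
  import Data.Nat.Properties as ℕ
  open import Data.Bool using (Bool; true; false)
  open import Data.Sign using (Sign)
  import Data.Sign as Sign
  open import Data.Integer
    using (ℤ; _+_; _*_; -_; 0ℤ; 1ℤ; -1ℤ; +_; -[1+_]; ∣_∣)
    renaming (_≤_ to _≤ℤ_)
  open import Data.Integer.Properties hiding (_≟_)
  import Data.Integer.Properties as ℤ using (_≟_)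
  open import Data.Fin using (Fin; zero; suc; _↑ˡ_; _↑ʳ_; splitAt; combine; remQuot; fromℕ<)
  open import Data.Fin.Patterns using (0F; 1F; 2F; 3F; 4F; 5F; 6F)
  open import Data.Fin.Properties
    using (_≟_; suc-injective; all?; splitAt-↑ˡ; splitAt-↑ʳ; splitAt⁻¹-↑ˡ; splitAt⁻¹-↑ʳ;
           remQuot-combine; combine-remQuot)
  open import Data.Product using (_×_; _,_; proj₁; proj₂; uncurry)
  open import Data.Sum using (_⊎_; inj₁; inj₂; [_,_]′)
  open import Data.Empty using (⊥-elim)
  open import Function using (_∘_; _⇔_; mk⇔; Equivalence)
  open import Relation.Binary.PropositionalEquality
  open import Data.Integer.Tactic.RingSolver renaming (solve-∀ to ℤ-solve-∀)
  open import Data.Nat.Tactic.RingSolver renaming (solve-∀ to ℕ-solve-∀)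
  open import Data.Nat.Divisibility using (_∣_; divides; ∣⇒≤)
  open import Data.Nat.Coprimality using (Coprime; coprime-divisor; gcd≡1⇒coprime)
  open import Relation.Nullary using (¬_; Dec; yes; no; does)
  open import Relation.Nullary.Decidable using (dec-true; dec-false; True; toWitness)
  open import Algebra.Properties.Semiring.Sum +-*-semiring
    using (sum; ∑-distrib-+; ∑-comm; *-distribˡ-sum)
  open import Algebra.Properties.AbelianGroup +-0-abelianGroup using (inverseˡ-unique; inverseʳ-unique)

  -- Finite sums.  The library's summation 'sum' agrees with the Σ[_] of the
  -- statement; we import its algebraic laws through this bridge.

  Σ≡sum : ∀ n (f : Fin n → ℤ) → Σ[ n ] f ≡ sum f
  Σ≡sum zero    f = refl
  Σ≡sum (suc n) f = cong (_+_ (f zero)) (Σ≡sum n (f ∘ suc))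

  Σ-cong : ∀ n {f g : Fin n → ℤ} → (∀ i → f i ≡ g i) → Σ[ n ] f ≡ Σ[ n ] g
  Σ-cong zero    eq = refl
  Σ-cong (suc n) eq = cong₂ _+_ (eq zero) (Σ-cong n (eq ∘ suc))

  Σ-zero : ∀ n {f : Fin n → ℤ} → (∀ i → f i ≡ 0ℤ) → Σ[ n ] f ≡ 0ℤ
  Σ-zero zero    eq = refl
  Σ-zero (suc n) eq = cong₂ _+_ (eq zero) (Σ-zero n (eq ∘ suc))

  Σ-+ : ∀ n (f g : Fin n → ℤ) → Σ[ n ] (λ i → f i + g i) ≡ Σ[ n ] f + Σ[ n ] g
  Σ-+ n f g = begin
    Σ[ n ] (λ i → f i + g i)  ≡⟨ Σ≡sum n _ ⟩
    sum (λ i → f i + g i)     ≡⟨ ∑-distrib-+ f g ⟩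
    sum f + sum g             ≡⟨ sym (cong₂ _+_ (Σ≡sum n f) (Σ≡sum n g)) ⟩
    Σ[ n ] f + Σ[ n ] g       ∎
    where open ≡-Reasoning

  Σ-+₃ : ∀ n (f g h : Fin n → ℤ) →
         Σ[ n ] (λ i → f i + (g i + h i)) ≡ Σ[ n ] f + (Σ[ n ] g + Σ[ n ] h)
  Σ-+₃ n f g h = trans (Σ-+ n f _) (cong (_+_ (Σ[ n ] f)) (Σ-+ n g h))

  Σ-*ˡ : ∀ n c (f : Fin n → ℤ) → Σ[ n ] (λ i → c * f i) ≡ c * Σ[ n ] f
  Σ-*ˡ n c f = begin
    Σ[ n ] (λ i → c * f i)  ≡⟨ Σ≡sum n _ ⟩
    sum (λ i → c * f i)     ≡⟨ sym (*-distribˡ-sum c f) ⟩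
    c * sum f               ≡⟨ sym (cong (c *_) (Σ≡sum n f)) ⟩
    c * Σ[ n ] f            ∎
    where open ≡-Reasoning

  Σ-*ʳ : ∀ n (f : Fin n → ℤ) c → Σ[ n ] (λ i → f i * c) ≡ Σ[ n ] f * c
  Σ-*ʳ n f c = begin
    Σ[ n ] (λ i → f i * c)  ≡⟨ Σ-cong n (λ i → *-comm (f i) c) ⟩
    Σ[ n ] (λ i → c * f i)  ≡⟨ Σ-*ˡ n c f ⟩
    c * Σ[ n ] f            ≡⟨ *-comm c _ ⟩
    Σ[ n ] f * c            ∎
    where open ≡-Reasoning

  Σ-neg : ∀ n (f : Fin n → ℤ) → Σ[ n ] (λ i → - f i) ≡ - Σ[ n ] f
  Σ-neg n f = begin
    Σ[ n ] (λ i → - f i)     ≡⟨ Σ-cong n (λ i → -1*i≡-i (f i)) ⟨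
    Σ[ n ] (λ i → -1ℤ * f i) ≡⟨ Σ-*ˡ n -1ℤ f ⟩
    -1ℤ * Σ[ n ] f           ≡⟨ -1*i≡-i _ ⟩
    - Σ[ n ] f               ∎
    where open ≡-Reasoning

  Σ-const : ∀ n v → Σ[ n ] (λ _ → v) ≡ + n * v
  Σ-const zero    v = refl
  Σ-const (suc n) v = begin
    v + Σ[ n ] (λ _ → v)  ≡⟨ cong (_+_ v) (Σ-const n v) ⟩
    v + + n * v           ≡⟨ cong (λ z → z + + n * v) (*-identityˡ v) ⟨
    1ℤ * v + + n * v      ≡⟨ *-distribʳ-+ v 1ℤ (+ n) ⟨
    + suc n * v           ∎
    where open ≡-Reasoning

  Σ-swap : ∀ m n (f : Fin m → Fin n → ℤ) →
           Σ[ m ] (λ i → Σ[ n ] (f i)) ≡ Σ[ n ] (λ j → Σ[ m ] (λ i → f i j))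
  Σ-swap m n f = begin
    Σ[ m ] (λ i → Σ[ n ] (f i))             ≡⟨ Σ-cong m (λ i → Σ≡sum n (f i)) ⟩
    Σ[ m ] (λ i → sum (f i))                ≡⟨ Σ≡sum m _ ⟩
    sum (λ i → sum (f i))                   ≡⟨ ∑-comm f ⟩
    sum (λ j → sum (λ i → f i j))           ≡⟨ Σ≡sum n _ ⟨
    Σ[ n ] (λ j → sum (λ i → f i j))        ≡⟨ Σ-cong n (λ j → Σ≡sum m (λ i → f i j)) ⟨
    Σ[ n ] (λ j → Σ[ m ] (λ i → f i j))     ∎
    where open ≡-Reasoning

  Σ-++ : ∀ a b (f : Fin (a ℕ.+ b) → ℤ) →
         Σ[ a ℕ.+ b ] f ≡ Σ[ a ] (λ i → f (i ↑ˡ b)) + Σ[ b ] (λ i → f (a ↑ʳ i))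
  Σ-++ zero    b f = sym (+-identityˡ _)
  Σ-++ (suc a) b f = trans (cong (_+_ (f zero)) (Σ-++ a b (f ∘ suc))) (sym (+-assoc (f zero) _ _))

  Σ-blocks : ∀ n t (f : Fin (n ℕ.* t) → ℤ) →
             Σ[ n ℕ.* t ] f ≡ Σ[ n ] (λ i → Σ[ t ] (λ k → f (combine i k)))
  Σ-blocks zero    t f = refl
  Σ-blocks (suc n) t f =
    trans (Σ-++ t (n ℕ.* t) f) (cong (_+_ (Σ[ t ] (λ k → f (k ↑ˡ n ℕ.* t)))) (Σ-blocks n t (f ∘ (t ↑ʳ_))))

  -- The Kronecker delta, scaling a value: δ i j v is v if i = j and 0 otherwise.
  -- It is defined through 'when' so that case distinctions on the Boolean are
  -- available to the lemmas below.

  when : Bool → ℤ → ℤ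
  when true  v = v
  when false v = 0ℤ

  δ : ∀ {n} → Fin n → Fin n → ℤ → ℤ
  δ i j v = when (does (i ≟ j)) v

  δ-refl : ∀ {n} (i : Fin n) v → δ i i v ≡ v
  δ-refl i v rewrite dec-true (i ≟ i) refl = refl

  δ-≢ : ∀ {n} {i j : Fin n} v → i ≢ j → δ i j v ≡ 0ℤ
  δ-≢ {i = i} {j} v i≢j rewrite dec-false (i ≟ j) i≢j = refl

  when-0 : ∀ b → when b 0ℤ ≡ 0ℤ
  when-0 true  = refl
  when-0 false = refl

  when-* : ∀ b u v → when b u * v ≡ when b (u * v)
  when-* true  u v = refl
  when-* false u v = refl

  Σ-when : ∀ n b (f : Fin n → ℤ) → Σ[ n ] (λ i → when b (f i)) ≡ when b (Σ[ n ] f)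
  Σ-when n true  f = refl
  Σ-when n false f = Σ-zero n (λ _ → refl)

  Σ-δ : ∀ n (i : Fin n) (g : Fin n → ℤ) → Σ[ n ] (λ j → δ i j (g j)) ≡ g i
  Σ-δ (suc n) zero    g = trans (cong (_+_ (g zero)) (Σ-zero n (λ _ → refl))) (+-identityʳ _)
  Σ-δ (suc n) (suc i) g = trans (+-identityˡ _) (Σ-δ n i (g ∘ suc))

  Σ-pair : ∀ n (f : Fin n → ℤ) {p q} → p ≢ q → (∀ j → p ≢ j → q ≢ j → f j ≡ 0ℤ) →
           Σ[ n ] f ≡ f p + f q
  Σ-pair n f {p} {q} p≢q outside = begin
    Σ[ n ] f                                   ≡⟨ Σ-cong n split ⟩
    Σ[ n ] (λ j → δ p j (f j) + δ q j (f j))   ≡⟨ Σ-+ n _ _ ⟩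
    Σ[ n ] (λ j → δ p j (f j)) + Σ[ n ] (λ j → δ q j (f j))
                                               ≡⟨ cong₂ _+_ (Σ-δ n p f) (Σ-δ n q f) ⟩
    f p + f q                                  ∎
    where
    open ≡-Reasoning
    split : ∀ j → f j ≡ δ p j (f j) + δ q j (f j)
    split j with p ≟ j | q ≟ j
    ... | yes refl | yes refl = ⊥-elim (p≢q refl)
    ... | yes _    | no _     = sym (+-identityʳ _)
    ... | no _     | yes _    = sym (+-identityˡ _)
    ... | no p≢j   | no q≢j   = outside j p≢j q≢j

  blocks : ∀ {n t} → (Fin n → Vect t) → Vect (n ℕ.* t)
  blocks {n} {t} b col = uncurry b (remQuot {n} t col)

  block-blocks : ∀ {n t} (b : Fin n → Vect t) i k → block {n} {t} (blocks b) i k ≡ b i k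
  block-blocks b i k = cong (uncurry b) (remQuot-combine i k)

  blockwise : ∀ {n t} {x y : Vect (n ℕ.* t)} →
              (∀ i k → block {n} {t} x i k ≡ block {n} {t} y i k) → ∀ col → x col ≡ y col
  blockwise {n} {t} {x} {y} eq col = begin
    x col                                   ≡⟨ cong x (combine-remQuot {n} t col) ⟨
    x (uncurry combine (remQuot {n} t col)) ≡⟨ eq _ _ ⟩
    y (uncurry combine (remQuot {n} t col)) ≡⟨ cong y (combine-remQuot {n} t col) ⟩
    y col                                   ∎
    where open ≡-Reasoning

  module _ {s t : ℕ} (A : Matrix s t) (n : ℕ) where

    nfold-top : ∀ j col → nfold A n (j ↑ˡ (n ℕ.* s)) col ≡ δ j (proj₂ (remQuot {n} t col)) 1ℤ
    nfold-top j col rewrite splitAt-↑ˡ t j (n ℕ.* s) with j ≟ proj₂ (remQuot {n} t col)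
    ... | yes _ = refl
    ... | no _  = refl

    nfold-diag : ∀ q col → nfold A n (t ↑ʳ q) col ≡
                 δ (proj₁ (remQuot {n} s q)) (proj₁ (remQuot {n} t col))
                   (A (proj₂ (remQuot {n} s q)) (proj₂ (remQuot {n} t col)))
    nfold-diag q col rewrite splitAt-↑ʳ t (n ℕ.* s) q with proj₁ (remQuot {n} s q) ≟ proj₁ (remQuot {n} t col)
    ... | yes _ = refl
    ... | no _  = refl

    top-row : ∀ x j → (nfold A n · x) (j ↑ˡ (n ℕ.* s)) ≡ Σ[ n ] (λ i → block {n} {t} x i j)
    top-row x j = begin
      Σ[ n ℕ.* t ] (λ col → nfold A n (j ↑ˡ _) col * x col)
        ≡⟨ Σ-blocks n t _ ⟩
      Σ[ n ] (λ i → Σ[ t ] (λ k → nfold A n (j ↑ˡ _) (combine i k) * x (combine i k)))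
        ≡⟨ Σ-cong n (λ i → Σ-cong t (λ k → entry i k)) ⟩
      Σ[ n ] (λ i → Σ[ t ] (λ k → δ j k (x (combine i k))))
        ≡⟨ Σ-cong n (λ i → Σ-δ t j _) ⟩
      Σ[ n ] (λ i → x (combine i j))
        ∎
      where
      open ≡-Reasoning
      entry : (i : Fin n) (k : Fin t) →
              nfold A n (j ↑ˡ _) (combine i k) * x (combine i k) ≡ δ j k (x (combine i k))
      entry i k = begin
        nfold A n (j ↑ˡ _) (combine i k) * x (combine i k)
          ≡⟨ cong (_* x (combine i k)) (trans (nfold-top j (combine i k))
                                              (cong (λ p → δ j (proj₂ p) 1ℤ) (remQuot-combine i k))) ⟩
        δ j k 1ℤ * x (combine i k)    ≡⟨ when-* (does (j ≟ k)) 1ℤ (x (combine i k)) ⟩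
        δ j k (1ℤ * x (combine i k))  ≡⟨ cong (δ j k) (*-identityˡ _) ⟩
        δ j k (x (combine i k))       ∎

    diag-row : ∀ x i′ a → (nfold A n · x) (t ↑ʳ combine i′ a) ≡ (A · block {n} {t} x i′) a
    diag-row x i′ a = begin
      Σ[ n ℕ.* t ] (λ col → nfold A n (t ↑ʳ combine i′ a) col * x col)
        ≡⟨ Σ-blocks n t _ ⟩
      Σ[ n ] (λ i → Σ[ t ] (λ k → nfold A n (t ↑ʳ combine i′ a) (combine i k) * x (combine i k)))
        ≡⟨ Σ-cong n (λ i → Σ-cong t (λ k →
             entry i k)) ⟩
      Σ[ n ] (λ i → Σ[ t ] (λ k → δ i′ i (A a k * x (combine i k))))
        ≡⟨ Σ-cong n (λ i → Σ-when t _ _) ⟩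
      Σ[ n ] (λ i → δ i′ i (Σ[ t ] (λ k → A a k * x (combine i k))))
        ≡⟨ Σ-δ n i′ _ ⟩
      Σ[ t ] (λ k → A a k * x (combine i′ k))
        ∎
      where
      open ≡-Reasoning
      entry : (i : Fin n) (k : Fin t) →
              nfold A n (t ↑ʳ combine i′ a) (combine i k) * x (combine i k) ≡ δ i′ i (A a k * x (combine i k))
      entry i k = trans (cong (_* x (combine i k)) (trans (nfold-diag (combine i′ a) (combine i k))
                          (cong₂ (λ p q → δ (proj₁ p) (proj₁ q) (A (proj₂ p) (proj₂ q)))
                                 (remQuot-combine i′ a) (remQuot-combine i k))))
                        (when-* (does (i′ ≟ i)) (A a k) (x (combine i k)))

    data RowIndex : Fin (t ℕ.+ n ℕ.* s) → Set where
      top  : ∀ j → RowIndex (j ↑ˡ (n ℕ.* s))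
      diag : ∀ i a → RowIndex (t ↑ʳ combine {n} {s} i a)

    rowIndex : ∀ r → RowIndex r
    rowIndex r with splitAt t r in eq
    ... | inj₁ j = subst RowIndex (splitAt⁻¹-↑ˡ eq) (top j)
    ... | inj₂ q = subst RowIndex (trans (cong (t ↑ʳ_) (combine-remQuot {n} s q)) (splitAt⁻¹-↑ʳ eq))
                         (diag (proj₁ (remQuot {n} s q)) (proj₂ (remQuot {n} s q)))

    nfold-kernel : ∀ x → InKernel (nfold A n) x ⇔
                   ((∀ k → Σ[ n ] (λ i → block {n} {t} x i k) ≡ 0ℤ) × (∀ i → InKernel A (block {n} {t} x i)))
    nfold-kernel x = mk⇔ to from
      where
      to : _
      to Ax≡0 = (λ k → trans (sym (top-row x k)) (Ax≡0 _))
              , (λ i a → trans (sym (diag-row x i a)) (Ax≡0 _))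
      from : _
      from (sums , diagonal) r with rowIndex r
      ... | top j    = trans (top-row x j) (sums j)
      ... | diag i a = trans (diag-row x i a) (diagonal i a)

  _⊑ᶻ_ : ℤ → ℤ → Set
  u ⊑ᶻ v = (∣ u ∣ ℕ.≤ ∣ v ∣) × (0ℤ ≤ℤ u * v)

  graver-dichotomy : ∀ {r c} {B : Matrix r c} {v y : Vect c} → InGraver B v → InKernel B y → y ⊑ v →
                     (∀ k → y k ≡ 0ℤ) ⊎ (∀ k → y k ≡ v k)
  graver-dichotomy {y = y} (_ , _ , minimal) By≡0 y⊑v with all? (λ k → y k ℤ.≟ 0ℤ)
  ... | yes y≡0 = inj₁ y≡0
  ... | no y≢0  = inj₂ (minimal y By≡0 y≢0 y⊑v)

  InKernel-cong : ∀ {r c} (B : Matrix r c) {u v : Vect c} → (∀ k → u k ≡ v k) → InKernel B u → InKernel B v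
  InKernel-cong {c = c} B u≡v Bu≡0 ρ = trans (Σ-cong c (λ k → cong (B ρ k *_) (sym (u≡v k)))) (Bu≡0 ρ)

  count-all : ∀ n {P : Fin n → Set} (P? : ∀ i → Dec (P i)) → (∀ i → P i) → count n P? ≡ n
  count-all zero    P? all = refl
  count-all (suc n) P? all with P? zero
  ... | yes _ = cong suc (count-all n (P? ∘ suc) (all ∘ suc))
  ... | no ¬p = ⊥-elim (¬p (all zero))

  -- Groups of indices.  Multiplicities a : Fin J → ℕ divide Fin (total a) into J
  -- consecutive groups, group g consisting of the a g slots 'slot a g q'; the
  -- group of an index is its 'owner'.

  total : ∀ {J} → (Fin J → ℕ) → ℕ
  total {zero}  a = 0
  total {suc J} a = a zero ℕ.+ total (a ∘ suc)

  slot : ∀ {J} (a : Fin J → ℕ) (g : Fin J) → Fin (a g) → Fin (total a)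
  slot {suc J} a zero    q = q ↑ˡ total (a ∘ suc)
  slot {suc J} a (suc g) q = a zero ↑ʳ slot (a ∘ suc) g q

  owner : ∀ {J} (a : Fin J → ℕ) → Fin (total a) → Fin J
  owner {suc J} a i = [ (λ _ → zero) , suc ∘ owner (a ∘ suc) ]′ (splitAt (a zero) i)

  owner-slot : ∀ {J} (a : Fin J → ℕ) g q → owner a (slot a g q) ≡ g
  owner-slot {suc J} a zero q rewrite splitAt-↑ˡ (a zero) q (total (a ∘ suc)) = refl
  owner-slot {suc J} a (suc g) q rewrite splitAt-↑ʳ (a zero) (total (a ∘ suc)) (slot (a ∘ suc) g q) =
    cong suc (owner-slot (a ∘ suc) g q)

  data IsSlot {J} (a : Fin J → ℕ) : Fin (total a) → Set where
    slot-at : ∀ g q → IsSlot a (slot a g q)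

  isSlot : ∀ {J} (a : Fin J → ℕ) i → IsSlot a i
  isSlot {suc J} a i with splitAt (a zero) i in eq
  ... | inj₁ q = subst (IsSlot a) (splitAt⁻¹-↑ˡ eq) (slot-at zero q)
  ... | inj₂ i′ with isSlot (a ∘ suc) i′
  ...   | slot-at g q = subst (IsSlot a) (splitAt⁻¹-↑ʳ eq) (slot-at (suc g) q)

  all-slots : ∀ {J} (a : Fin J → ℕ) {P : Fin (total a) → Set} → (∀ g q → P (slot a g q)) → ∀ i → P i
  all-slots a all i with isSlot a i
  ... | slot-at g q = all g q

  Σ-groups : ∀ {J} (a : Fin J → ℕ) (f : Fin (total a) → ℤ) →
             Σ[ total a ] f ≡ Σ[ J ] (λ g → Σ[ a g ] (λ q → f (slot a g q)))
  Σ-groups {zero}  a f = refl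
  Σ-groups {suc J} a f =
    trans (Σ-++ (a zero) _ f) (cong (_+_ (Σ[ a zero ] (λ q → f (q ↑ˡ _)))) (Σ-groups (a ∘ suc) (f ∘ (a zero ↑ʳ_))))

  Bit : ℤ → Set
  Bit b = b ≡ 0ℤ ⊎ b ≡ 1ℤ

  record OnesCount (n : ℕ) (b : Fin n → ℤ) : Set where
    field
      ones     : ℕ
      sum≡ones : Σ[ n ] b ≡ + ones
      ones≤n   : ones ℕ.≤ n
      no-ones  : ones ≡ 0 → ∀ i → b i ≡ 0ℤ
      all-ones : ones ≡ n → ∀ i → b i ≡ 1ℤ

  onesCount : ∀ n (b : Fin n → ℤ) → (∀ i → Bit (b i)) → OnesCount n b
  onesCount zero b bits = record
    { ones = 0 ; sum≡ones = refl ; ones≤n = ℕ.z≤n ; no-ones = λ _ () ; all-ones = λ _ () }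
  onesCount (suc n) b bits with onesCount n (b ∘ suc) (bits ∘ suc) | bits zero
  ... | rest | inj₁ b₀≡0 = record
    { ones     = ones
    ; sum≡ones = trans (cong₂ _+_ b₀≡0 sum≡ones) (+-identityˡ _)
    ; ones≤n   = ℕ.m≤n⇒m≤1+n ones≤n
    ; no-ones  = λ { e zero → b₀≡0 ; e (suc i) → no-ones e i }
    ; all-ones = λ e → ⊥-elim (ℕ.<⇒≢ (ℕ.s≤s ones≤n) e)
    }
    where open OnesCount rest
  ... | rest | inj₂ b₀≡1 = record
    { ones     = suc ones
    ; sum≡ones = cong₂ _+_ b₀≡1 sum≡ones
    ; ones≤n   = ℕ.s≤s ones≤n
    ; no-ones  = λ ()
    ; all-ones = λ { e zero → b₀≡1 ; e (suc i) → all-ones (ℕ.suc-injective e) i }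
    }
    where open OnesCount rest

  IsRelation : ∀ {J c} → (Fin J → Vect c) → (Fin J → ℤ) → Set
  IsRelation {J} G d = ∀ k → Σ[ J ] (λ g → d g * G g k) ≡ 0ℤ

  IsPrimitiveRelation : ∀ {J c} → (Fin J → Vect c) → (Fin J → ℕ) → Set
  IsPrimitiveRelation G a =
    IsRelation G (+_ ∘ a) ×
    (∀ s → (∀ g → s g ℕ.≤ a g) → IsRelation G (+_ ∘ s) → (∀ g → s g ≡ 0) ⊎ (∀ g → s g ≡ a g))

  module Stacking {r c J : ℕ} (B : Matrix r c) (G : Fin J → Vect c) (a : Fin J → ℕ) where

    n : ℕ
    n = total a

    stack : Vect (n ℕ.* c)
    stack = blocks (λ i → G (owner a i))

    stack-block : ∀ i k → block {n} {c} stack i k ≡ G (owner a i) k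
    stack-block = block-blocks (λ i → G (owner a i))

    stack-type : (∀ g → NonZero (G g)) → type n {c} stack ≡ n
    stack-type G≢0 = count-all n _ λ i stackᵢ≡0 →
      G≢0 (owner a i) (λ k → trans (sym (stack-block i k)) (stackᵢ≡0 k))

    -- The stack lies in the kernel: its blocks do, and its block sum is Σ a_g G_g = 0.
    stack-kernel : (∀ g → InKernel B (G g)) → IsRelation G (+_ ∘ a) → InKernel (nfold B n) stack
    stack-kernel BG≡0 relation = Equivalence.from (nfold-kernel B n stack)
      (column-sums , λ i → InKernel-cong B (λ k → sym (stack-block i k)) (BG≡0 (owner a i)))
      where
      column-sums : ∀ k → Σ[ n ] (λ i → block {n} {c} stack i k) ≡ 0ℤ
      column-sums k = begin
        Σ[ n ] (λ i → block {n} {c} stack i k)                 ≡⟨ Σ-cong n (λ i → stack-block i k) ⟩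
        Σ[ n ] (λ i → G (owner a i) k)                         ≡⟨ Σ-groups a _ ⟩
        Σ[ J ] (λ g → Σ[ a g ] (λ q → G (owner a (slot a g q)) k))
          ≡⟨ Σ-cong J (λ g → Σ-cong (a g) (λ q → cong (λ h → G h k) (owner-slot a g q))) ⟩
        Σ[ J ] (λ g → Σ[ a g ] (λ _ → G g k))                  ≡⟨ Σ-cong J (λ g → Σ-const (a g) (G g k)) ⟩
        Σ[ J ] (λ g → + a g * G g k)                           ≡⟨ relation k ⟩
        0ℤ                                                     ∎
        where open ≡-Reasoning

    -- A kernel vector y ⊑ stack has, in every block, 0 or the full G_g; the
    -- numbers s_g of full blocks in group g form a relation 0 ≤ s ≤ a.
    module Below (graver : ∀ g → InGraver B (G g)) (y : Vect (n ℕ.* c))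
                 (By≡0 : InKernel (nfold B n) y) (y⊑stack : y ⊑ stack) where

      kernel : (∀ k → Σ[ n ] (λ i → block {n} {c} y i k) ≡ 0ℤ) × (∀ i → InKernel B (block {n} {c} y i))
      kernel = Equivalence.to (nfold-kernel B n y) By≡0

      conformal : ∀ i → block {n} {c} y i ⊑ G (owner a i)
      conformal i k = subst (y (combine i k) ⊑ᶻ_) (stack-block i k) (y⊑stack (combine i k))

      dichotomy : ∀ i → (∀ k → block {n} {c} y i k ≡ 0ℤ) ⊎ (∀ k → block {n} {c} y i k ≡ G (owner a i) k)
      dichotomy i = graver-dichotomy {B = B} (graver (owner a i)) (proj₂ kernel i) (conformal i)

      bit : Fin n → ℤ
      bit i = [ (λ _ → 0ℤ) , (λ _ → 1ℤ) ]′ (dichotomy i)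

      scaled : ∀ i k → block {n} {c} y i k ≡ bit i * G (owner a i) k
      scaled i k with dichotomy i
      ... | inj₁ yᵢ≡0 = trans (yᵢ≡0 k) (sym (*-zeroˡ (G (owner a i) k)))
      ... | inj₂ yᵢ≡G = trans (yᵢ≡G k) (sym (*-identityˡ (G (owner a i) k)))

      is-bit : ∀ i → Bit (bit i)
      is-bit i with dichotomy i
      ... | inj₁ _ = inj₁ refl
      ... | inj₂ _ = inj₂ refl

      counts : ∀ g → OnesCount (a g) (λ q → bit (slot a g q))
      counts g = onesCount (a g) _ (λ q → is-bit (slot a g q))

      s : Fin J → ℕ
      s g = OnesCount.ones (counts g)

      s≤a : ∀ g → s g ℕ.≤ a g
      s≤a g = OnesCount.ones≤n (counts g)

      relation : IsRelation G (+_ ∘ s)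
      relation k = begin
        Σ[ J ] (λ g → + s g * G g k)
          ≡⟨ Σ-cong J (λ g → cong (_* G g k) (sym (OnesCount.sum≡ones (counts g)))) ⟩
        Σ[ J ] (λ g → Σ[ a g ] (λ q → bit (slot a g q)) * G g k)
          ≡⟨ Σ-cong J (λ g → sym (Σ-*ʳ (a g) _ (G g k))) ⟩
        Σ[ J ] (λ g → Σ[ a g ] (λ q → bit (slot a g q) * G g k))
          ≡⟨ Σ-cong J (λ g → Σ-cong (a g) (λ q →
               trans (cong (λ h → bit (slot a g q) * G h k) (sym (owner-slot a g q)))
                     (sym (scaled (slot a g q) k)))) ⟩
        Σ[ J ] (λ g → Σ[ a g ] (λ q → block {n} {c} y (slot a g q) k))
          ≡⟨ Σ-groups a _ ⟨
        Σ[ n ] (λ i → block {n} {c} y i k)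
          ≡⟨ proj₁ kernel k ⟩
        0ℤ
          ∎
        where open ≡-Reasoning

      empty : (∀ g → s g ≡ 0) → ∀ col → y col ≡ 0ℤ
      empty s≡0 = blockwise {n} {c} λ i k → begin
        block {n} {c} y i k      ≡⟨ scaled i k ⟩
        bit i * G (owner a i) k  ≡⟨ cong (_* G (owner a i) k)
                                        (all-slots a {λ i → bit i ≡ 0ℤ} (λ g → OnesCount.no-ones (counts g) (s≡0 g)) i) ⟩
        0ℤ * G (owner a i) k     ≡⟨ *-zeroˡ (G (owner a i) k) ⟩
        0ℤ                       ∎
        where open ≡-Reasoning

      full : (∀ g → s g ≡ a g) → ∀ col → y col ≡ stack col
      full s≡a = blockwise {n} {c} λ i k → begin
        block {n} {c} y i k      ≡⟨ scaled i k ⟩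
        bit i * G (owner a i) k  ≡⟨ cong (_* G (owner a i) k)
                                        (all-slots a {λ i → bit i ≡ 1ℤ} (λ g → OnesCount.all-ones (counts g) (s≡a g)) i) ⟩
        1ℤ * G (owner a i) k     ≡⟨ *-identityˡ (G (owner a i) k) ⟩
        G (owner a i) k          ≡⟨ stack-block i k ⟨
        block {n} {c} stack i k  ∎
        where open ≡-Reasoning

    stack-minimal : (∀ g → InGraver B (G g)) → IsPrimitiveRelation G a →
                    ∀ y → InKernel (nfold B n) y → NonZero y → y ⊑ stack → ∀ col → y col ≡ stack col
    stack-minimal graver (_ , minimal-relation) y By≡0 y≢0 y⊑stack =
      [ (λ s≡0 → ⊥-elim (y≢0 (empty s≡0))) , full ]′ (minimal-relation s s≤a relation)
      where open Below graver y By≡0 y⊑stack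

    stack-graver : (∀ g → InGraver B (G g)) → IsPrimitiveRelation G a → 0 ℕ.< n → InGraver (nfold B n) stack
    stack-graver graver prim n>0 =
      stack-kernel (λ g → proj₁ (graver g)) (proj₁ prim) ,
      (λ stack≡0 → proj₁ (proj₂ (graver (owner a i₀)))
                     (λ k → trans (sym (stack-block i₀ k)) (stack≡0 (combine i₀ k)))) ,
      stack-minimal graver prim
      where
      i₀ : Fin n
      i₀ = fromℕ< n>0

  -- A vector of ℤ^{3m} is read as a table of
  -- m rows of length 3 (row j lists the edges at vertex j of the m-side, column r
  -- those at vertex r of the 3-side).  (1,1,1)^(m) x = 0 iff its table is
  -- balanced: every row and every column sums to zero.

  Table : ℕ → Set
  Table m = Fin m → Vect 3

  Balanced : ∀ {m} → Table m → Set
  Balanced {m} T = (∀ r → Σ[ m ] (λ j → T j r) ≡ 0ℤ) × (∀ j → Σ[ 3 ] (T j) ≡ 0ℤ)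

  Balanced-cong : ∀ {m} {T U : Table m} → (∀ j r → T j r ≡ U j r) → Balanced T → Balanced U
  Balanced-cong {m} T≡U (columns , rows) =
    (λ r → trans (sym (Σ-cong m (λ j → T≡U j r))) (columns r)) ,
    (λ j → trans (sym (Σ-cong 3 (T≡U j))) (rows j))

  incidence-kernel : ∀ m x → InKernel (nfold ones111 m) x ⇔ Balanced (block {m} {3} x)
  incidence-kernel m x = mk⇔
    (λ kernel → let (columns , rows) = Equivalence.to (nfold-kernel ones111 m x) kernel in
                columns , λ j → trans (sym (row-sum j zero)) (rows j zero))
    (λ (columns , rows) → Equivalence.from (nfold-kernel ones111 m x) (columns , λ j a → trans (row-sum j a) (rows j)))
    where
    row-sum : ∀ j a → (ones111 · block {m} {3} x j) a ≡ Σ[ 3 ] (block {m} {3} x j)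
    row-sum j a = Σ-cong 3 {g = block {m} {3} x j} (λ k → *-identityˡ _)

  -- Hexagons.  The 6-cycle of K_{3,m} through the vertices x₀, x₁, x₂ of the
  -- m-side: vertex x_ρ carries +1 in column ρ and −1 in column ρ+1 (mod 3).

  role : Fin 3 → Vect 3
  role 0F 0F = 1ℤ
  role 0F 1F = -1ℤ
  role 0F 2F = 0ℤ
  role 1F 0F = 0ℤ
  role 1F 1F = 1ℤ
  role 1F 2F = -1ℤ
  role 2F 0F = -1ℤ
  role 2F 1F = 0ℤ
  role 2F 2F = 1ℤ

  hexagon : ∀ {m} → Fin m → Fin m → Fin m → Table m
  hexagon x₀ x₁ x₂ j r = δ x₀ j (role 0F r) + (δ x₁ j (role 1F r) + δ x₂ j (role 2F r))

  hexagon-balanced : ∀ {m} (x₀ x₁ x₂ : Fin m) → Balanced (hexagon x₀ x₁ x₂)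
  hexagon-balanced {m} x₀ x₁ x₂ = columns , rows
    where
    open ≡-Reasoning
    roles-cancel : ∀ r → role 0F r + (role 1F r + role 2F r) ≡ 0ℤ
    roles-cancel 0F = refl
    roles-cancel 1F = refl
    roles-cancel 2F = refl
    columns : ∀ r → Σ[ m ] (λ j → hexagon x₀ x₁ x₂ j r) ≡ 0ℤ
    columns r = begin
      Σ[ m ] (λ j → hexagon x₀ x₁ x₂ j r)
        ≡⟨ Σ-+₃ m (λ j → δ x₀ j (role 0F r)) (λ j → δ x₁ j (role 1F r)) (λ j → δ x₂ j (role 2F r)) ⟩
      Σ[ m ] (λ j → δ x₀ j (role 0F r)) + (Σ[ m ] (λ j → δ x₁ j (role 1F r)) + Σ[ m ] (λ j → δ x₂ j (role 2F r)))
        ≡⟨ cong₂ _+_ (Σ-δ m x₀ _) (cong₂ _+_ (Σ-δ m x₁ _) (Σ-δ m x₂ _)) ⟩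
      role 0F r + (role 1F r + role 2F r)
        ≡⟨ roles-cancel r ⟩
      0ℤ ∎
    rows : ∀ j → Σ[ 3 ] (hexagon x₀ x₁ x₂ j) ≡ 0ℤ
    rows j = begin
      Σ[ 3 ] (hexagon x₀ x₁ x₂ j)
        ≡⟨ Σ-+₃ 3 (λ r → δ x₀ j (role 0F r)) (λ r → δ x₁ j (role 1F r)) (λ r → δ x₂ j (role 2F r)) ⟩
      Σ[ 3 ] (λ r → δ x₀ j (role 0F r)) + (Σ[ 3 ] (λ r → δ x₁ j (role 1F r)) + Σ[ 3 ] (λ r → δ x₂ j (role 2F r)))
        ≡⟨ cong₂ _+_ (Σ-when 3 (does (x₀ ≟ j)) (role 0F))
                     (cong₂ _+_ (Σ-when 3 (does (x₁ ≟ j)) (role 1F)) (Σ-when 3 (does (x₂ ≟ j)) (role 2F))) ⟩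
      δ x₀ j 0ℤ + (δ x₁ j 0ℤ + δ x₂ j 0ℤ)
        ≡⟨ cong₂ _+_ (when-0 (does (x₀ ≟ j))) (cong₂ _+_ (when-0 (does (x₁ ≟ j))) (when-0 (does (x₂ ≟ j)))) ⟩
      0ℤ ∎

  -- A balanced table supported on a hexagon with distinct vertices is a multiple
  -- of it: each vertex of the 6-cycle has two incident edges, so going around the
  -- cycle the entries of the table alternate in sign with constant absolute value.
  module _ {m} {x₀ x₁ x₂ : Fin m} (x₀≢x₁ : x₀ ≢ x₁) (x₀≢x₂ : x₀ ≢ x₂) (x₁≢x₂ : x₁ ≢ x₂) where

    private
      H : Table m
      H = hexagon x₀ x₁ x₂

    hexagon-at-x₀ : ∀ r → H x₀ r ≡ role 0F r
    hexagon-at-x₀ r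
      rewrite δ-refl x₀ (role 0F r) | δ-≢ (role 1F r) (≢-sym x₀≢x₁) | δ-≢ (role 2F r) (≢-sym x₀≢x₂) =
      +-identityʳ _

    hexagon-at-x₁ : ∀ r → H x₁ r ≡ role 1F r
    hexagon-at-x₁ r rewrite δ-≢ (role 0F r) x₀≢x₁ | δ-refl x₁ (role 1F r) | δ-≢ (role 2F r) (≢-sym x₁≢x₂) =
      trans (+-identityˡ _) (+-identityʳ _)

    hexagon-at-x₂ : ∀ r → H x₂ r ≡ role 2F r
    hexagon-at-x₂ r rewrite δ-≢ (role 0F r) x₀≢x₂ | δ-≢ (role 1F r) x₁≢x₂ | δ-refl x₂ (role 2F r) =
      trans (+-identityˡ _) (+-identityˡ _)

    hexagon-off : ∀ {j} r → x₀ ≢ j → x₁ ≢ j → x₂ ≢ j → H j r ≡ 0ℤ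
    hexagon-off r x₀≢j x₁≢j x₂≢j
      rewrite δ-≢ (role 0F r) x₀≢j | δ-≢ (role 1F r) x₁≢j | δ-≢ (role 2F r) x₂≢j = refl

    hexagon-column₁-off : ∀ {j} → x₀ ≢ j → x₁ ≢ j → H j 1F ≡ 0ℤ
    hexagon-column₁-off {j} x₀≢j x₁≢j rewrite δ-≢ -1ℤ x₀≢j | δ-≢ 1ℤ x₁≢j =
      trans (+-identityˡ _) (trans (+-identityˡ _) (when-0 (does (x₂ ≟ j))))

    hexagon-column₂-off : ∀ {j} → x₁ ≢ j → x₂ ≢ j → H j 2F ≡ 0ℤ
    hexagon-column₂-off {j} x₁≢j x₂≢j rewrite δ-≢ -1ℤ x₁≢j | δ-≢ 1ℤ x₂≢j =
      trans (+-identityʳ _) (when-0 (does (x₀ ≟ j)))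

    vertex : ∀ j → x₀ ≡ j ⊎ x₁ ≡ j ⊎ x₂ ≡ j ⊎ (x₀ ≢ j × x₁ ≢ j × x₂ ≢ j)
    vertex j with x₀ ≟ j | x₁ ≟ j | x₂ ≟ j
    ... | yes x₀≡j | _        | _        = inj₁ x₀≡j
    ... | no _     | yes x₁≡j | _        = inj₂ (inj₁ x₁≡j)
    ... | no _     | no _     | yes x₂≡j = inj₂ (inj₂ (inj₁ x₂≡j))
    ... | no x₀≢j  | no x₁≢j  | no x₂≢j  = inj₂ (inj₂ (inj₂ (x₀≢j , x₁≢j , x₂≢j)))

    hexagon-multiple : ∀ Y → Balanced Y → (∀ j r → H j r ≡ 0ℤ → Y j r ≡ 0ℤ) →
                       ∀ j r → Y j r ≡ Y x₀ 0F * H j r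
    hexagon-multiple Y (columns , rows) support = multiple
      where
      α : ℤ
      α = Y x₀ 0F

      opposite : ∀ {n} (f : Fin n → ℤ) {p q} → p ≢ q → Σ[ n ] f ≡ 0ℤ →
                 (∀ j → p ≢ j → q ≢ j → f j ≡ 0ℤ) → f q ≡ - f p
      opposite {n} f {p} {q} p≢q sum≡0 rest =
        inverseʳ-unique (f p) (f q) (trans (sym (Σ-pair n f p≢q rest)) sum≡0)

      -- Around the cycle: vertex x₀ (columns 0, 1), column 1 (vertices x₀, x₁),
      -- vertex x₁ (columns 1, 2), column 2 (vertices x₁, x₂), vertex x₂ (columns 2, 0).
      Y₀₁ : Y x₀ 1F ≡ - α
      Y₀₁ = opposite (Y x₀) (λ ()) (rows x₀) λ
        { 0F p≢ _ → ⊥-elim (p≢ refl) ; 1F _ q≢ → ⊥-elim (q≢ refl) ; 2F _ _ → support x₀ 2F (hexagon-at-x₀ 2F) }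

      Y₁₁ : Y x₁ 1F ≡ α
      Y₁₁ = begin
        Y x₁ 1F    ≡⟨ opposite (λ j → Y j 1F) x₀≢x₁ (columns 1F)
                        (λ j x₀≢j x₁≢j → support j 1F (hexagon-column₁-off x₀≢j x₁≢j)) ⟩
        - Y x₀ 1F  ≡⟨ cong -_ Y₀₁ ⟩
        - - α      ≡⟨ neg-involutive α ⟩
        α          ∎
        where open ≡-Reasoning

      Y₁₂ : Y x₁ 2F ≡ - α
      Y₁₂ = trans (opposite (Y x₁) (λ ()) (rows x₁) λ
        { 0F _ _ → support x₁ 0F (hexagon-at-x₁ 0F) ; 1F p≢ _ → ⊥-elim (p≢ refl) ; 2F _ q≢ → ⊥-elim (q≢ refl) })
        (cong -_ Y₁₁)

      Y₂₂ : Y x₂ 2F ≡ α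
      Y₂₂ = begin
        Y x₂ 2F    ≡⟨ opposite (λ j → Y j 2F) x₁≢x₂ (columns 2F)
                        (λ j x₁≢j x₂≢j → support j 2F (hexagon-column₂-off x₁≢j x₂≢j)) ⟩
        - Y x₁ 2F  ≡⟨ cong -_ Y₁₂ ⟩
        - - α      ≡⟨ neg-involutive α ⟩
        α          ∎
        where open ≡-Reasoning

      Y₂₀ : Y x₂ 0F ≡ - α
      Y₂₀ = trans (opposite (Y x₂) (λ ()) (rows x₂) λ
        { 0F _ q≢ → ⊥-elim (q≢ refl) ; 1F _ _ → support x₂ 1F (hexagon-at-x₂ 1F) ; 2F p≢ _ → ⊥-elim (p≢ refl) })
        (cong -_ Y₂₂)

      α*-1 : α * -1ℤ ≡ - α
      α*-1 = trans (*-comm α -1ℤ) (-1*i≡-i α)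

      at-x₀ : ∀ r → Y x₀ r ≡ α * role 0F r
      at-x₀ 0F = sym (*-identityʳ α)
      at-x₀ 1F = trans Y₀₁ (sym α*-1)
      at-x₀ 2F = trans (support x₀ 2F (hexagon-at-x₀ 2F)) (sym (*-zeroʳ α))

      at-x₁ : ∀ r → Y x₁ r ≡ α * role 1F r
      at-x₁ 0F = trans (support x₁ 0F (hexagon-at-x₁ 0F)) (sym (*-zeroʳ α))
      at-x₁ 1F = trans Y₁₁ (sym (*-identityʳ α))
      at-x₁ 2F = trans Y₁₂ (sym α*-1)

      at-x₂ : ∀ r → Y x₂ r ≡ α * role 2F r
      at-x₂ 0F = trans Y₂₀ (sym α*-1)
      at-x₂ 1F = trans (support x₂ 1F (hexagon-at-x₂ 1F)) (sym (*-zeroʳ α))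
      at-x₂ 2F = trans Y₂₂ (sym (*-identityʳ α))

      multiple : ∀ j r → Y j r ≡ α * H j r
      multiple j r with vertex j
      ... | inj₁ refl                   = trans (at-x₀ r) (cong (α *_) (sym (hexagon-at-x₀ r)))
      ... | inj₂ (inj₁ refl)            = trans (at-x₁ r) (cong (α *_) (sym (hexagon-at-x₁ r)))
      ... | inj₂ (inj₂ (inj₁ refl))     = trans (at-x₂ r) (cong (α *_) (sym (hexagon-at-x₂ r)))
      ... | inj₂ (inj₂ (inj₂ (x₀≢j , x₁≢j , x₂≢j))) =
        trans (support j r off) (sym (trans (cong (α *_) off) (*-zeroʳ α)))
        where off = hexagon-off r x₀≢j x₁≢j x₂≢j

  record Cycle (m : ℕ) : Set where
    constructor cycle
    field
      orientation : Sign
      v₀ v₁ v₂    : Fin m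

  signed : Sign → ℤ → ℤ
  signed Sign.+ v = v
  signed Sign.- v = - v

  cycleTable : ∀ {m} → Cycle m → Table m
  cycleTable (cycle σ x₀ x₁ x₂) j r = signed σ (hexagon x₀ x₁ x₂ j r)

  cycleVector : ∀ {m} → Cycle m → Vect (m ℕ.* 3)
  cycleVector c = blocks (cycleTable c)

  Distinct : ∀ {m} → Cycle m → Set
  Distinct (cycle _ x₀ x₁ x₂) = x₀ ≢ x₁ × x₀ ≢ x₂ × x₁ ≢ x₂

  cycle-balanced : ∀ {m} (c : Cycle m) → Balanced (cycleTable c)
  cycle-balanced (cycle Sign.+ x₀ x₁ x₂) = hexagon-balanced x₀ x₁ x₂
  cycle-balanced {m} (cycle Sign.- x₀ x₁ x₂) =
    (λ r → trans (Σ-neg m (λ j → hexagon x₀ x₁ x₂ j r)) (cong -_ (columns r))) ,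
    (λ j → trans (Σ-neg 3 (hexagon x₀ x₁ x₂ j)) (cong -_ (rows j)))
    where
    columns : ∀ r → Σ[ m ] (λ j → hexagon x₀ x₁ x₂ j r) ≡ 0ℤ
    columns = proj₁ (hexagon-balanced x₀ x₁ x₂)
    rows : ∀ j → Σ[ 3 ] (hexagon x₀ x₁ x₂ j) ≡ 0ℤ
    rows = proj₂ (hexagon-balanced x₀ x₁ x₂)

  unit-small : ∀ σ {k} → ¬ (suc (suc k) ℕ.≤ ∣ signed σ 1ℤ ∣)
  unit-small Sign.+ (ℕ.s≤s ())
  unit-small Sign.- (ℕ.s≤s ())

  below-unit : ∀ σ y → y ⊑ᶻ signed σ 1ℤ → y ≡ 0ℤ ⊎ y ≡ signed σ 1ℤ
  below-unit σ      (+ 0)           _       = inj₁ refl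
  below-unit Sign.+ (+ 1)           _       = inj₂ refl
  below-unit Sign.- (+ 1)           (_ , ())
  below-unit σ      (+ suc (suc _)) (≤ , _) = ⊥-elim (unit-small σ ≤)
  below-unit Sign.+ -[1+ 0 ]        (_ , ())
  below-unit Sign.- -[1+ 0 ]        _       = inj₂ refl
  below-unit σ      -[1+ suc _ ]    (≤ , _) = ⊥-elim (unit-small σ ≤)

  signed-unit-* : ∀ σ v → signed σ 1ℤ * v ≡ signed σ v
  signed-unit-* Sign.+ v = *-identityˡ v
  signed-unit-* Sign.- v = -1*i≡-i v

  ∣signed∣ : ∀ σ v → ∣ signed σ v ∣ ≡ ∣ v ∣
  ∣signed∣ Sign.+ v = refl
  ∣signed∣ Sign.- v = ∣-i∣≡∣i∣ v

  cycle-circuit : ∀ {m} (c : Cycle m) → Distinct c → ∀ Y → Balanced Y →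
                  (∀ j r → Y j r ⊑ᶻ cycleTable c j r) →
                  (∀ j r → Y j r ≡ 0ℤ) ⊎ (∀ j r → Y j r ≡ cycleTable c j r)
  cycle-circuit {m} (cycle σ x₀ x₁ x₂) (x₀≢x₁ , x₀≢x₂ , x₁≢x₂) Y balanced conformal =
    [ (λ α≡0 → inj₁ λ j r → trans (multiple j r) (trans (cong (_* H j r) α≡0) (*-zeroˡ (H j r))))
    , (λ α≡σ → inj₂ λ j r → trans (multiple j r) (trans (cong (_* H j r) α≡σ) (signed-unit-* σ (H j r))))
    ]′ (below-unit σ (Y x₀ 0F)
         (subst (λ v → Y x₀ 0F ⊑ᶻ signed σ v) (hexagon-at-x₀ x₀≢x₁ x₀≢x₂ x₁≢x₂ 0F) (conformal x₀ 0F)))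
    where
    H : Table m
    H = hexagon x₀ x₁ x₂
    support : ∀ j r → H j r ≡ 0ℤ → Y j r ≡ 0ℤ
    support j r H≡0 = ∣i∣≡0⇒i≡0 (ℕ.n≤0⇒n≡0
      (subst (∣ Y j r ∣ ℕ.≤_) (trans (∣signed∣ σ (H j r)) (cong ∣_∣ H≡0)) (proj₁ (conformal j r))))
    multiple : ∀ j r → Y j r ≡ Y x₀ 0F * H j r
    multiple = hexagon-multiple x₀≢x₁ x₀≢x₂ x₁≢x₂ Y balanced support

  cycle-nonzero : ∀ {m} (c : Cycle m) → Distinct c → cycleTable c (Cycle.v₀ c) 0F ≢ 0ℤ
  cycle-nonzero (cycle σ x₀ x₁ x₂) (x₀≢x₁ , x₀≢x₂ , x₁≢x₂)
    rewrite hexagon-at-x₀ x₀≢x₁ x₀≢x₂ x₁≢x₂ 0F = unit≢0 σ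
    where
    unit≢0 : ∀ σ → signed σ 1ℤ ≢ 0ℤ
    unit≢0 Sign.+ ()
    unit≢0 Sign.- ()

  cycle-graver : ∀ {m} (c : Cycle m) → Distinct c → InGraver (nfold ones111 m) (cycleVector c)
  cycle-graver {m} c distinct = kernel , nonzero , minimal
    where
    T : Table m
    T = cycleTable c
    kernel : InKernel (nfold ones111 m) (cycleVector c)
    kernel = Equivalence.from (incidence-kernel m _) (Balanced-cong (λ j r → sym (block-blocks T j r)) (cycle-balanced c))
    nonzero : NonZero (cycleVector c)
    nonzero v≡0 = cycle-nonzero c distinct (trans (sym (block-blocks T (Cycle.v₀ c) 0F)) (v≡0 (combine (Cycle.v₀ c) 0F)))
    minimal : ∀ y → InKernel (nfold ones111 m) y → NonZero y → y ⊑ cycleVector c → ∀ col → y col ≡ cycleVector c col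
    minimal y ky y≢0 y⊑v =
      [ (λ Y≡0 → ⊥-elim (y≢0 (blockwise {m} {3} Y≡0)))
      , (λ Y≡T → blockwise {m} {3} (λ j r → trans (Y≡T j r) (sym (block-blocks T j r))))
      ]′ (cycle-circuit c distinct (block {m} {3} y) (Equivalence.to (incidence-kernel m y) ky)
            (λ j r → subst (y (combine j r) ⊑ᶻ_) (block-blocks T j r) (y⊑v (combine j r))))

  IsTableRelation : ∀ {J m} → (Fin J → Cycle m) → (Fin J → ℤ) → Set
  IsTableRelation {J} F d = ∀ j r → Σ[ J ] (λ g → d g * cycleTable (F g) j r) ≡ 0ℤ

  table⇒relation : ∀ {J m} (F : Fin J → Cycle m) d → IsTableRelation F d → IsRelation (cycleVector ∘ F) d
  table⇒relation F d relation col = relation _ _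

  relation⇒table : ∀ {J m} (F : Fin J → Cycle m) d → IsRelation (cycleVector ∘ F) d → IsTableRelation F d
  relation⇒table {J} F d relation j r =
    trans (Σ-cong J (λ g → cong (d g *_) (sym (block-blocks (cycleTable (F g)) j r)))) (relation (combine j r))

  x*[y*z]≡y*[x*z] : ∀ x y z → x * (y * z) ≡ y * (x * z)
  x*[y*z]≡y*[x*z] x y z = trans (sym (*-assoc x y z)) (trans (cong (_* z) (*-comm x y)) (*-assoc y x z))

  certified : ∀ {N M R} (K : Fin N → Fin M → Fin R → ℤ) (w : Fin M → Fin R → ℤ) (e : Fin N → ℤ) →
              (∀ i → Σ[ M ] (λ j → Σ[ R ] (λ r → w j r * K i j r)) ≡ e i) →
              ∀ (d : Fin N → ℤ) → (∀ j r → Σ[ N ] (λ i → d i * K i j r) ≡ 0ℤ) →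
              Σ[ N ] (λ i → d i * e i) ≡ 0ℤ
  certified {N} {M} {R} K w e combines d solution = begin
    Σ[ N ] (λ i → d i * e i)
      ≡⟨ Σ-cong N (λ i → cong (d i *_) (sym (combines i))) ⟩
    Σ[ N ] (λ i → d i * Σ[ M ] (λ j → Σ[ R ] (λ r → w j r * K i j r)))
      ≡⟨ Σ-cong N (λ i → trans (sym (Σ-*ˡ M (d i) (λ j → Σ[ R ] (λ r → w j r * K i j r))))
                             (Σ-cong M (λ j → sym (Σ-*ˡ R (d i) (λ r → w j r * K i j r))))) ⟩
    Σ[ N ] (λ i → Σ[ M ] (λ j → Σ[ R ] (λ r → d i * (w j r * K i j r))))
      ≡⟨ Σ-swap N M (λ i j → Σ[ R ] (λ r → d i * (w j r * K i j r))) ⟩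
    Σ[ M ] (λ j → Σ[ N ] (λ i → Σ[ R ] (λ r → d i * (w j r * K i j r))))
      ≡⟨ Σ-cong M (λ j → Σ-swap N R (λ i r → d i * (w j r * K i j r))) ⟩
    Σ[ M ] (λ j → Σ[ R ] (λ r → Σ[ N ] (λ i → d i * (w j r * K i j r))))
      ≡⟨ Σ-cong M (λ j → Σ-cong R (λ r → trans (Σ-cong N (λ i → x*[y*z]≡y*[x*z] (d i) (w j r) (K i j r)))
                                                (Σ-*ˡ N (w j r) (λ i → d i * K i j r)))) ⟩
    Σ[ M ] (λ j → Σ[ R ] (λ r → w j r * Σ[ N ] (λ i → d i * K i j r)))
      ≡⟨ Σ-zero M (λ j → Σ-zero R {λ r → w j r * Σ[ N ] (λ i → d i * K i j r)}
                                   (λ r → trans (cong (w j r *_) (solution j r)) (*-zeroʳ (w j r)))) ⟩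
    0ℤ ∎
    where open ≡-Reasoning

  by-evaluation : ∀ {m n} {P : Fin m → Fin n → Set} (P? : ∀ i j → Dec (P i j)) →
                  True (all? (λ i → all? (P? i))) → ∀ i j → P i j
  by-evaluation P? holds = toWitness holds

  base : Fin 7 → Cycle 4
  base 0F = cycle Sign.+ 0F 2F 1F
  base 1F = cycle Sign.- 0F 1F 2F
  base 2F = cycle Sign.+ 1F 0F 2F
  base 3F = cycle Sign.+ 1F 3F 0F
  base 4F = cycle Sign.+ 3F 1F 0F
  base 5F = cycle Sign.- 1F 2F 3F
  base 6F = cycle Sign.+ 2F 1F 3F

  base-multiplicity : Fin 7 → ℕ
  base-multiplicity 0F = 7
  base-multiplicity 1F = 1
  base-multiplicity 2F = 6
  base-multiplicity 3F = 3
  base-multiplicity 4F = 3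
  base-multiplicity 5F = 2
  base-multiplicity 6F = 5

  base-relation : IsTableRelation base (+_ ∘ base-multiplicity)
  base-relation = by-evaluation (λ j r → Σ[ 7 ] (λ g → + base-multiplicity g * cycleTable (base g) j r) ℤ.≟ 0ℤ) _

  -- The relations among the base cycles are the multiples of it: for each t,
  -- the weights 'certificate t' combine the 12 entry equations into
  -- 7 d_t − a_t d_0 = 0 (a = base-multiplicity).
  certificate : Fin 7 → Fin 4 → Fin 3 → ℤ
  certificate 1F 0F 0F = -1ℤ
  certificate 1F 0F 1F = + 2
  certificate 1F 1F 2F = + 2
  certificate 1F 2F 0F = + 2
  certificate 1F 3F 1F = -1ℤ
  certificate 2F 0F 1F = + 3
  certificate 2F 1F 0F = 1ℤ
  certificate 2F 2F 0F = -1ℤ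
  certificate 2F 2F 2F = + 2
  certificate 2F 3F 2F = 1ℤ
  certificate 3F 0F 0F = -1ℤ
  certificate 3F 0F 2F = + 2
  certificate 3F 1F 0F = 1ℤ
  certificate 3F 2F 2F = 1ℤ
  certificate 3F 3F 1F = + 3
  certificate 4F 0F 0F = - + 2
  certificate 4F 1F 2F = - + 2
  certificate 4F 2F 1F = 1ℤ
  certificate 4F 3F 0F = 1ℤ
  certificate 4F 3F 1F = - + 2
  certificate 5F 0F 1F = 1ℤ
  certificate 5F 1F 0F = - + 2
  certificate 5F 2F 1F = - + 2
  certificate 5F 2F 2F = 1ℤ
  certificate 5F 3F 2F = - + 2
  certificate 6F 0F 1F = 1ℤ
  certificate 6F 1F 2F = - + 2
  certificate 6F 2F 0F = 1ℤ
  certificate 6F 2F 1F = - + 2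
  certificate 6F 3F 0F = - + 2
  certificate _  _  _  = 0ℤ

  scaled-difference : Fin 7 → Fin 7 → ℤ
  scaled-difference t i = δ t i (+ 7) + δ 0F i (- + base-multiplicity t)

  certificate-combines : ∀ t i → Σ[ 4 ] (λ j → Σ[ 3 ] (λ r → certificate t j r * cycleTable (base i) j r)) ≡
                                 scaled-difference t i
  certificate-combines = by-evaluation (λ t i → Σ[ 4 ] (λ j → Σ[ 3 ] (λ r → certificate t j r * cycleTable (base i) j r))
                                                  ℤ.≟ scaled-difference t i) _

  base-rigid : ∀ d → IsTableRelation base d → ∀ t → + 7 * d t ≡ d 0F * + base-multiplicity t
  base-rigid d relation t = begin
    + 7 * d t                   ≡⟨ *-comm (+ 7) (d t) ⟩
    d t * + 7                   ≡⟨ inverseˡ-unique _ _ difference ⟩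
    - (d 0F * - + a)            ≡⟨ neg-distribʳ-* (d 0F) (- + a) ⟩
    d 0F * - - + a              ≡⟨ cong (d 0F *_) (neg-involutive (+ a)) ⟩
    d 0F * + a                  ∎
    where
    open ≡-Reasoning
    a : ℕ
    a = base-multiplicity t
    u*δ : ∀ u {n} (i j : Fin n) v → u * δ i j v ≡ δ i j (u * v)
    u*δ u i j v = trans (*-comm u _) (trans (when-* (does (i ≟ j)) v u) (cong (δ i j) (*-comm v u)))
    difference : d t * + 7 + d 0F * - + a ≡ 0ℤ
    difference = begin
      d t * + 7 + d 0F * - + a
        ≡⟨ cong₂ _+_ (Σ-δ 7 t (λ i → d i * + 7)) (Σ-δ 7 0F (λ i → d i * - + a)) ⟨
      Σ[ 7 ] (λ i → δ t i (d i * + 7)) + Σ[ 7 ] (λ i → δ 0F i (d i * - + a))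
        ≡⟨ Σ-+ 7 (λ i → δ t i (d i * + 7)) (λ i → δ 0F i (d i * - + a)) ⟨
      Σ[ 7 ] (λ i → δ t i (d i * + 7) + δ 0F i (d i * - + a))
        ≡⟨ Σ-cong 7 (λ i → trans (cong₂ _+_ (sym (u*δ (d i) t i (+ 7))) (sym (u*δ (d i) 0F i (- + a))))
                                 (sym (*-distribˡ-+ (d i) (δ t i (+ 7)) (δ 0F i (- + a))))) ⟩
      Σ[ 7 ] (λ i → d i * scaled-difference t i)
        ≡⟨ certified (λ i → cycleTable (base i)) (certificate t) (scaled-difference t) (certificate-combines t) d relation ⟩
      0ℤ ∎

  -- Family k consists of 1 + others k cycles of K_{3,4+k};
  -- cycle 0F is the pivot, positively oriented with multiplicity 7.  Family k+1
  -- adds a new vertex 0 (shifting the old vertices up): the pivot is replaced by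
  -- the three cycles obtained by substituting the new vertex for one of its
  -- vertices, each with multiplicity 7, and every other cycle is kept with
  -- doubled multiplicity.  The three new cycles sum to twice the pivot on the old
  -- vertices and to zero on the new one.

  shape : ∀ {m} → Cycle m → Table m
  shape (cycle _ x₀ x₁ x₂) = hexagon x₀ x₁ x₂

  lift : ∀ {m} → Cycle m → Cycle (suc m)
  lift (cycle σ x₀ x₁ x₂) = cycle σ (suc x₀) (suc x₁) (suc x₂)

  suc-≢ : ∀ {m} {x y : Fin m} → x ≢ y → suc x ≢ suc y
  suc-≢ x≢y = x≢y ∘ suc-injective

  through-new : ∀ {m} → Cycle m → Fin 3 → Cycle (suc m)
  through-new (cycle _ x₀ x₁ x₂) 0F = cycle Sign.+ 0F (suc x₁) (suc x₂)
  through-new (cycle _ x₀ x₁ x₂) 1F = cycle Sign.+ (suc x₀) 0F (suc x₂)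
  through-new (cycle _ x₀ x₁ x₂) 2F = cycle Sign.+ (suc x₀) (suc x₁) 0F

  lift-new-row : ∀ {m} (c : Cycle m) r → cycleTable (lift c) 0F r ≡ 0ℤ
  lift-new-row (cycle Sign.+ _ _ _) r = refl
  lift-new-row (cycle Sign.- _ _ _) r = refl

  gadget : ∀ {m} (c : Cycle m) j r →
           cycleTable (through-new c 0F) (suc j) r +
             (cycleTable (through-new c 1F) (suc j) r + cycleTable (through-new c 2F) (suc j) r)
           ≡ + 2 * shape c j r
  gadget (cycle _ x₀ x₁ x₂) j r = twice (δ x₀ j (role 0F r)) (δ x₁ j (role 1F r)) (δ x₂ j (role 2F r))
    where
    twice : ∀ a b c → (0ℤ + (b + c)) + ((a + (0ℤ + c)) + (a + (b + 0ℤ))) ≡ + 2 * (a + (b + c))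
    twice = ℤ-solve-∀

  others : ℕ → ℕ
  others zero    = 6
  others (suc k) = 2 ℕ.+ others k

  family : ∀ k → Fin (suc (others k)) → Cycle (4 ℕ.+ k)
  family zero                   = base
  family (suc k) 0F             = through-new (family k 0F) 0F
  family (suc k) 1F             = through-new (family k 0F) 1F
  family (suc k) 2F             = through-new (family k 0F) 2F
  family (suc k) (suc (suc (suc g))) = lift (family k (suc g))

  multiplicity : ∀ k → Fin (suc (others k)) → ℕ
  multiplicity zero                   = base-multiplicity
  multiplicity (suc k) 0F             = 7
  multiplicity (suc k) 1F             = 7
  multiplicity (suc k) 2F             = 7
  multiplicity (suc k) (suc (suc (suc g))) = 2 ℕ.* multiplicity k (suc g)

  pivot-multiplicity : ∀ k → multiplicity k 0F ≡ 7
  pivot-multiplicity zero    = refl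
  pivot-multiplicity (suc k) = refl

  pivot-positive : ∀ k j r → cycleTable (family k 0F) j r ≡ shape (family k 0F) j r
  pivot-positive zero    j r = refl
  pivot-positive (suc k) j r = refl

  family-distinct : ∀ k g → Distinct (family k g)
  family-distinct zero 0F = (λ ()) , (λ ()) , (λ ())
  family-distinct zero 1F = (λ ()) , (λ ()) , (λ ())
  family-distinct zero 2F = (λ ()) , (λ ()) , (λ ())
  family-distinct zero 3F = (λ ()) , (λ ()) , (λ ())
  family-distinct zero 4F = (λ ()) , (λ ()) , (λ ())
  family-distinct zero 5F = (λ ()) , (λ ()) , (λ ())
  family-distinct zero 6F = (λ ()) , (λ ()) , (λ ())
  family-distinct (suc k) 0F = (λ ()) , (λ ()) , suc-≢ (proj₂ (proj₂ (family-distinct k 0F)))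
  family-distinct (suc k) 1F = (λ ()) , suc-≢ (proj₁ (proj₂ (family-distinct k 0F))) , (λ ())
  family-distinct (suc k) 2F = suc-≢ (proj₁ (family-distinct k 0F)) , (λ ()) , (λ ())
  family-distinct (suc k) (suc (suc (suc g))) with family-distinct k (suc g)
  ... | x₀≢x₁ , x₀≢x₂ , x₁≢x₂ = suc-≢ x₀≢x₁ , suc-≢ x₀≢x₂ , suc-≢ x₁≢x₂

  -- On the new vertex only the three new
  -- cycles are present and their roles cancel; on an old vertex they add up to
  -- twice the pivot, so the equation is twice the corresponding one of family k.
  family-relation : ∀ k → IsTableRelation (family k) (+_ ∘ multiplicity k)
  family-relation zero = base-relation
  family-relation (suc k) 0F r = begin
    + 7 * T 0F 0F r + (+ 7 * T 1F 0F r + (+ 7 * T 2F 0F r + rest))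
      ≡⟨ cong (λ z → + 7 * T 0F 0F r + (+ 7 * T 1F 0F r + (+ 7 * T 2F 0F r + z))) rest≡0 ⟩
    + 7 * T 0F 0F r + (+ 7 * T 1F 0F r + (+ 7 * T 2F 0F r + 0ℤ))
      ≡⟨ new-row r ⟩
    0ℤ ∎
    where
    open ≡-Reasoning
    T : Fin (3 ℕ.+ others k) → Table (5 ℕ.+ k)
    T g = cycleTable (family (suc k) g)
    rest : ℤ
    rest = Σ[ others k ] (λ g → + (2 ℕ.* multiplicity k (suc g)) * cycleTable (lift (family k (suc g))) 0F r)
    rest≡0 : rest ≡ 0ℤ
    rest≡0 = Σ-zero (others k) λ g →
      trans (cong (_*_ (+ (2 ℕ.* multiplicity k (suc g)))) (lift-new-row (family k (suc g)) r))
            (*-zeroʳ (+ (2 ℕ.* multiplicity k (suc g))))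
    new-row : ∀ r → + 7 * T 0F 0F r + (+ 7 * T 1F 0F r + (+ 7 * T 2F 0F r + 0ℤ)) ≡ 0ℤ
    new-row 0F = refl
    new-row 1F = refl
    new-row 2F = refl
  family-relation (suc k) (suc j) r = begin
    + 7 * T 0F + (+ 7 * T 1F + (+ 7 * T 2F + Σ[ others k ] (λ g → + (2 ℕ.* a (suc g)) * U (suc g))))
      ≡⟨ cong (λ z → + 7 * T 0F + (+ 7 * T 1F + (+ 7 * T 2F + z))) doubled ⟩
    + 7 * T 0F + (+ 7 * T 1F + (+ 7 * T 2F + + 2 * S))
      ≡⟨ regroup (T 0F) (T 1F) (T 2F) S ⟩
    + 7 * (T 0F + (T 1F + T 2F)) + + 2 * S
      ≡⟨ cong (λ z → + 7 * z + + 2 * S) (trans (gadget (family k 0F) j r) (cong (_*_ (+ 2)) (sym (pivot-positive k j r)))) ⟩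
    + 7 * (+ 2 * U 0F) + + 2 * S
      ≡⟨ factor (U 0F) S ⟩
    + 2 * (+ 7 * U 0F + S)
      ≡⟨ cong (λ z → + 2 * (+ z * U 0F + S)) (sym (pivot-multiplicity k)) ⟩
    + 2 * (+ a 0F * U 0F + S)
      ≡⟨ cong (_*_ (+ 2)) (family-relation k j r) ⟩
    0ℤ ∎
    where
    open ≡-Reasoning
    a : Fin (suc (others k)) → ℕ
    a = multiplicity k
    T : Fin (3 ℕ.+ others k) → ℤ
    T g = cycleTable (family (suc k) g) (suc j) r
    U : Fin (suc (others k)) → ℤ
    U g = cycleTable (family k g) j r
    S : ℤ
    S = Σ[ others k ] (λ g → + a (suc g) * U (suc g))
    doubled : Σ[ others k ] (λ g → + (2 ℕ.* a (suc g)) * U (suc g)) ≡ + 2 * S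
    doubled = trans (Σ-cong (others k) (λ g → trans (cong (_* U (suc g)) (pos-* 2 (a (suc g))))
                                                   (*-assoc (+ 2) (+ a (suc g)) (U (suc g)))))
                    (Σ-*ˡ (others k) (+ 2) _)
    regroup : ∀ x y z s → + 7 * x + (+ 7 * y + (+ 7 * z + + 2 * s)) ≡ + 7 * (x + (y + z)) + + 2 * s
    regroup = ℤ-solve-∀
    factor : ∀ u s → + 7 * (+ 2 * u) + + 2 * s ≡ + 2 * (+ 7 * u + s)
    factor = ℤ-solve-∀

  -- The new vertex forces d_0 = d_1 = d_2, after
  -- which (2 d_0, d_3, d_4, …) is a relation of family k.
  family-rigid : ∀ k d → IsTableRelation (family k) d → ∀ g → + 7 * d g ≡ d 0F * + multiplicity k g
  family-rigid zero = base-rigid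
  family-rigid (suc k) d relation = result
    where
    a : Fin (suc (others k)) → ℕ
    a = multiplicity k
    T : Fin (3 ℕ.+ others k) → Table (5 ℕ.+ k)
    T g = cycleTable (family (suc k) g)
    rest : ∀ j r → ℤ
    rest j r = Σ[ others k ] (λ g → d (suc (suc (suc g))) * cycleTable (family (suc k) (suc (suc (suc g)))) j r)
    rest-new-row : ∀ r → rest 0F r ≡ 0ℤ
    rest-new-row r = Σ-zero (others k) (λ g → trans (cong (_*_ (d (suc (suc (suc g))))) (lift-new-row (family k (suc g)) r))
                                                   (*-zeroʳ (d (suc (suc (suc g))))))

    d₂≡d₀ : d 2F ≡ d 0F
    d₂≡d₀ = solve-for-c (d 0F) (d 1F) (d 2F) (rest 0F 0F) (rest-new-row 0F) (relation 0F 0F)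
      where
      solve-for-c : ∀ x y z R → R ≡ 0ℤ → x * 1ℤ + (y * 0ℤ + (z * -1ℤ + R)) ≡ 0ℤ → z ≡ x
      solve-for-c x y z R refl eq = sym (trans (inverseˡ-unique x (- z) (trans (identity x y z) eq)) (neg-involutive z))
        where
        identity : ∀ x y z → x + - z ≡ x * 1ℤ + (y * 0ℤ + (z * -1ℤ + 0ℤ))
        identity = ℤ-solve-∀
    d₁≡d₀ : d 1F ≡ d 0F
    d₁≡d₀ = solve-for-y (d 0F) (d 1F) (d 2F) (rest 0F 1F) (rest-new-row 1F) (relation 0F 1F)
      where
      solve-for-y : ∀ x y z R → R ≡ 0ℤ → x * -1ℤ + (y * 1ℤ + (z * 0ℤ + R)) ≡ 0ℤ → y ≡ x
      solve-for-y x y z R refl eq = sym (trans (inverseˡ-unique x (- y) (trans (identity x y z) (cong -_ eq))) (neg-involutive y))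
        where
        identity : ∀ x y z → x + - y ≡ - (x * -1ℤ + (y * 1ℤ + (z * 0ℤ + 0ℤ)))
        identity = ℤ-solve-∀

    halved : Fin (suc (others k)) → ℤ
    halved 0F      = + 2 * d 0F
    halved (suc g) = d (suc (suc (suc g)))

    halved-relation : IsTableRelation (family k) halved
    halved-relation j r = begin
      + 2 * d 0F * cycleTable (family k 0F) j r + rest (suc j) r
        ≡⟨ cong (λ z → + 2 * d 0F * z + rest (suc j) r) (pivot-positive k j r) ⟩
      + 2 * d 0F * shape (family k 0F) j r + rest (suc j) r
        ≡⟨ cong (_+ rest (suc j) r) (trans (*-assoc (+ 2) (d 0F) _)
             (trans (x*[y*z]≡y*[x*z] (+ 2) (d 0F) _) (cong (_*_ (d 0F)) (sym (gadget (family k 0F) j r))))) ⟩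
      d 0F * (T 0F (suc j) r + (T 1F (suc j) r + T 2F (suc j) r)) + rest (suc j) r
        ≡⟨ distribute (d 0F) (T 0F (suc j) r) (T 1F (suc j) r) (T 2F (suc j) r) (rest (suc j) r) ⟩
      d 0F * T 0F (suc j) r + (d 0F * T 1F (suc j) r + (d 0F * T 2F (suc j) r + rest (suc j) r))
        ≡⟨ cong₂ (λ y z → d 0F * T 0F (suc j) r + (y * T 1F (suc j) r + (z * T 2F (suc j) r + rest (suc j) r)))
                 (sym d₁≡d₀) (sym d₂≡d₀) ⟩
      d 0F * T 0F (suc j) r + (d 1F * T 1F (suc j) r + (d 2F * T 2F (suc j) r + rest (suc j) r))
        ≡⟨ relation (suc j) r ⟩
      0ℤ ∎
      where
      open ≡-Reasoning
      distribute : ∀ x p q s R → x * (p + (q + s)) + R ≡ x * p + (x * q + (x * s + R))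
      distribute = ℤ-solve-∀

    induced : ∀ g → + 7 * halved g ≡ halved 0F * + a g
    induced = family-rigid k halved halved-relation

    result : ∀ g → + 7 * d g ≡ d 0F * + multiplicity (suc k) g
    result 0F = *-comm (+ 7) (d 0F)
    result 1F = trans (cong (_*_ (+ 7)) d₁≡d₀) (*-comm (+ 7) (d 0F))
    result 2F = trans (cong (_*_ (+ 7)) d₂≡d₀) (*-comm (+ 7) (d 0F))
    result (suc (suc (suc g))) = begin
      + 7 * d (suc (suc (suc g)))      ≡⟨ induced (suc g) ⟩
      + 2 * d 0F * + a (suc g)         ≡⟨ cong (_* + a (suc g)) (*-comm (+ 2) (d 0F)) ⟩
      d 0F * + 2 * + a (suc g)         ≡⟨ *-assoc (d 0F) (+ 2) (+ a (suc g)) ⟩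
      d 0F * (+ 2 * + a (suc g))       ≡⟨ cong (_*_ (d 0F)) (pos-* 2 (a (suc g))) ⟨
      d 0F * + (2 ℕ.* a (suc g))       ∎
      where open ≡-Reasoning

  -- By rigidity, a relation 0 ≤ s ≤ a satisfies 7 s_g = s_0 a_g.
  -- Some multiplicity is 2^k, so 7 divides s_0 · 2^k and hence s_0 (7 is odd);
  -- as s_0 ≤ a_0 = 7, either s_0 = 0 (and s = 0) or s_0 = 7 (and s = a).

  -- The cycle of family k with multiplicity 2^k (the second base cycle, doubled k times).
  power-index : ∀ k → Fin (others k)
  power-index zero    = 0F
  power-index (suc k) = suc (suc (power-index k))

  power-multiplicity : ∀ k → multiplicity k (suc (power-index k)) ≡ 2 ℕ.^ k
  power-multiplicity zero    = refl
  power-multiplicity (suc k) = cong (2 ℕ.*_) (power-multiplicity k)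

  coprime-7-2 : Coprime 7 2
  coprime-7-2 = gcd≡1⇒coprime refl

  7∣2^k*x⇒7∣x : ∀ k x → 7 ∣ 2 ℕ.^ k ℕ.* x → 7 ∣ x
  7∣2^k*x⇒7∣x zero    x 7∣x = subst (7 ∣_) (ℕ.*-identityˡ x) 7∣x
  7∣2^k*x⇒7∣x (suc k) x 7∣2^[1+k]*x =
    7∣2^k*x⇒7∣x k x (coprime-divisor {o = 2 ℕ.^ k ℕ.* x} coprime-7-2
                       (subst (7 ∣_) (ℕ.*-assoc 2 (2 ℕ.^ k) x) 7∣2^[1+k]*x))

  multiple-of-7-≤7 : ∀ x → x ℕ.≤ 7 → 7 ∣ x → x ≡ 0 ⊎ x ≡ 7
  multiple-of-7-≤7 zero    _   _   = inj₁ refl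
  multiple-of-7-≤7 (suc x) x≤7 7∣x = inj₂ (ℕ.≤-antisym x≤7 (∣⇒≤ 7∣x))

  family-primitive : ∀ k → IsPrimitiveRelation (cycleVector ∘ family k) (multiplicity k)
  family-primitive k = table⇒relation (family k) (+_ ∘ multiplicity k) (family-relation k) , minimal
    where
    a : Fin (suc (others k)) → ℕ
    a = multiplicity k
    minimal : ∀ s → (∀ g → s g ℕ.≤ a g) → IsRelation (cycleVector ∘ family k) (+_ ∘ s) →
              (∀ g → s g ≡ 0) ⊎ (∀ g → s g ≡ a g)
    minimal s s≤a relation =
      [ (λ s₀≡0 → inj₁ λ g → ℕ.*-cancelˡ-≡ (s g) 0 7 (trans (proportional g) (cong (ℕ._* a g) s₀≡0)))
      , (λ s₀≡7 → inj₂ λ g → ℕ.*-cancelˡ-≡ (s g) (a g) 7 (trans (proportional g) (cong (ℕ._* a g) s₀≡7)))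
      ]′ (multiple-of-7-≤7 (s 0F) s₀≤7 7∣s₀)
      where
      proportional : ∀ g → 7 ℕ.* s g ≡ s 0F ℕ.* a g
      proportional g = +-injective (begin
        + (7 ℕ.* s g)       ≡⟨ pos-* 7 (s g) ⟩
        + 7 * + s g         ≡⟨ family-rigid k (+_ ∘ s) (relation⇒table (family k) (+_ ∘ s) relation) g ⟩
        + s 0F * + a g      ≡⟨ pos-* (s 0F) (a g) ⟨
        + (s 0F ℕ.* a g)    ∎)
        where open ≡-Reasoning
      s₀≤7 : s 0F ℕ.≤ 7
      s₀≤7 = subst (s 0F ℕ.≤_) (pivot-multiplicity k) (s≤a 0F)
      7∣s₀ : 7 ∣ s 0F
      7∣s₀ = 7∣2^k*x⇒7∣x k (s 0F) (divides (s (suc (power-index k))) (begin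
        2 ℕ.^ k ℕ.* s 0F                        ≡⟨ ℕ.*-comm (2 ℕ.^ k) (s 0F) ⟩
        s 0F ℕ.* 2 ℕ.^ k                        ≡⟨ cong (s 0F ℕ.*_) (power-multiplicity k) ⟨
        s 0F ℕ.* a (suc (power-index k))        ≡⟨ proportional (suc (power-index k)) ⟨
        7 ℕ.* s (suc (power-index k))           ≡⟨ ℕ.*-comm 7 (s (suc (power-index k))) ⟩
        s (suc (power-index k)) ℕ.* 7           ∎))
        where open ≡-Reasoning

  total-double : ∀ {J} (a : Fin J → ℕ) → total (λ g → 2 ℕ.* a g) ≡ 2 ℕ.* total a
  total-double {zero}  a = refl
  total-double {suc J} a = trans (cong (2 ℕ.* a 0F ℕ.+_) (total-double (a ∘ suc))) (sym (ℕ.*-distribˡ-+ 2 (a 0F) _))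

  family-size : ∀ k → total (multiplicity k) ℕ.+ 7 ≡ 17 ℕ.* 2 ℕ.^ suc k
  family-size zero    = refl
  family-size (suc k) = begin
    7 ℕ.+ (7 ℕ.+ (7 ℕ.+ total (λ g → 2 ℕ.* multiplicity k (suc g)))) ℕ.+ 7
      ≡⟨ cong (λ t → 7 ℕ.+ (7 ℕ.+ (7 ℕ.+ t)) ℕ.+ 7) (total-double (multiplicity k ∘ suc)) ⟩
    7 ℕ.+ (7 ℕ.+ (7 ℕ.+ 2 ℕ.* rest)) ℕ.+ 7
      ≡⟨ regroup rest ⟩
    2 ℕ.* (7 ℕ.+ rest ℕ.+ 7)
      ≡⟨ cong (λ p → 2 ℕ.* (p ℕ.+ rest ℕ.+ 7)) (pivot-multiplicity k) ⟨
    2 ℕ.* (total (multiplicity k) ℕ.+ 7)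
      ≡⟨ cong (2 ℕ.*_) (family-size k) ⟩
    2 ℕ.* (17 ℕ.* 2 ℕ.^ suc k)
      ≡⟨ ℕ.*-comm 2 (17 ℕ.* 2 ℕ.^ suc k) ⟩
    17 ℕ.* 2 ℕ.^ suc k ℕ.* 2
      ≡⟨ ℕ.*-assoc 17 (2 ℕ.^ suc k) 2 ⟩
    17 ℕ.* (2 ℕ.^ suc k ℕ.* 2)
      ≡⟨ cong (17 ℕ.*_) (ℕ.*-comm (2 ℕ.^ suc k) 2) ⟩
    17 ℕ.* 2 ℕ.^ suc (suc k) ∎
    where
    open ≡-Reasoning
    rest : ℕ
    rest = total (multiplicity k ∘ suc)
    regroup : ∀ t → 7 ℕ.+ (7 ℕ.+ (7 ℕ.+ 2 ℕ.* t)) ℕ.+ 7 ≡ 2 ℕ.* (7 ℕ.+ t ℕ.+ 7)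
    regroup = ℕ-solve-∀

  graver-complexity-bound : ∀ k → GraverComplexity≥ (nfold ones111 (4 ℕ.+ k)) (17 ℕ.* 2 ℕ.^ suc k ℕ.∸ 7)
  graver-complexity-bound k =
    n , stack , stack-graver graver (family-primitive k) n>0 ,
    ℕ.≤-reflexive (begin
      17 ℕ.* 2 ℕ.^ suc k ℕ.∸ 7       ≡⟨ cong (ℕ._∸ 7) (family-size k) ⟨
      n ℕ.+ 7 ℕ.∸ 7                  ≡⟨ ℕ.m+n∸n≡m n 7 ⟩
      n                              ≡⟨ stack-type (λ g → proj₁ (proj₂ (graver g))) ⟨
      type n stack                   ∎)
    where
    open ≡-Reasoning
    open Stacking (nfold ones111 (4 ℕ.+ k)) (cycleVector ∘ family k) (multiplicity k)
    graver : ∀ g → InGraver (nfold ones111 (4 ℕ.+ k)) (cycleVector (family k g))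
    graver g = cycle-graver (family k g) (family-distinct k g)
    n>0 : 0 ℕ.< n
    n>0 = subst (λ p → 0 ℕ.< p ℕ.+ total (multiplicity k ∘ suc)) (sym (pivot-multiplicity k)) (ℕ.s≤s ℕ.z≤n)


open Construction using (graver-complexity-bound)
open import Data.Nat using (_<_; _*_; _^_; _∸_; s≤s)

-- A proof of 3 < m exhibits m as 4 + k, and then m − 3 = k + 1.
theorem1p4 : ∀ (m : ℕ) → 3 < m → GraverComplexity≥ (nfold ones111 m) (17 * 2 ^ (m ∸ 3) ∸ 7)
theorem1p4 _ (s≤s (s≤s (s≤s (s≤s {n = k} _)))) = graver-complexity-bound k
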